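{- Let $M$ be a (loosely) vertically $k$-connected matroid on $E$, where $k\ge2$ and $r(M)\ge\max\{3k-5,2\}$. Then $M$ (that is, the connectivity system $(E,\lambda_M)$) has a unique tangle $\mathcal T$ of order $k$. Moreover, a subset $A\subseteq E$ belongs to $\mathcal T$ if and only if $r(A)\le k-2$.
   Context: For a matroid $M$ on $E$ with rank function $r$, $\lambda_M(X)=r(X)+r(E-X)-r(M)+1$. $M$ is (loosely) vertically $k$-connected if for every partition $(A,B)$ of $E$ with $\lambda_M(A)\le k-1$, either $r(A)\le k-2$ or $r(B)\le k-2$. A tangle of order $k$ in $M$ is a collection $\mathcal T$ of subsets of $E$ such that (T1) $\lambda_M(A)<k$ for all $A\in\mathcal T$; (T2) if $\lambda_M(A)\le k-1$ then $A\in\mathcal T$ or $E-A\in\mathcal T$; (T3) if $A,B,C\in\mathcal T$ then $A\cup B\cup C\ne E$; (T4) $E-\{e\}\notin\mathcal T$ for each $e\in E$. -}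

module Defs where

open import Data.Nat using (ℕ; _+_; _∸_; _≤_; _<_)
open import Data.Fin using (Fin)
open import Data.Fin.Subset using (Subset; ⊥; ⊤; ∁; _∩_; _∪_; _⊆_; _-_; ∣_∣)
open import Data.Sum using (_⊎_)
open import Data.Product using (_×_)
open import Relation.Binary.PropositionalEquality using (_≡_)
open import Relation.Nullary using (¬_)

record Matroid (n : ℕ) : Set where
  field
    r         : Subset n → ℕ
    r-bounded : ∀ X → r X ≤ ∣ X ∣
    r-mono    : ∀ X Y → X ⊆ Y → r X ≤ r Y
    r-submod  : ∀ X Y → r (X ∪ Y) + r (X ∩ Y) ≤ r X + r Y

module _ {n : ℕ} (M : Matroid n) where
  open Matroid M

  rankM : ℕ
  rankM = r ⊤

  -- λ_M(X) = r(X) + r(E − X) − r(M) + 1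
  -- (the truncated subtraction is exact, since r(X) + r(E−X) ≥ r(E) by submodularity)
  conn : Subset n → ℕ
  conn X = (r X + r (∁ X)) ∸ rankM + 1

  VerticallyConnected : ℕ → Set
  VerticallyConnected k =
    ∀ (A : Subset n) → conn A ≤ k ∸ 1 → r A ≤ k ∸ 2 ⊎ r (∁ A) ≤ k ∸ 2

  record IsTangle (k : ℕ) (𝒯 : Subset n → Set) : Set where
    field
      T1 : ∀ A → 𝒯 A → conn A < k
      T2 : ∀ A → conn A ≤ k ∸ 1 → 𝒯 A ⊎ 𝒯 (∁ A)
      T3 : ∀ A B C → 𝒯 A → 𝒯 B → 𝒯 C → ¬ (A ∪ (B ∪ C) ≡ ⊤)
      T4 : ∀ e → ¬ 𝒯 (⊤ - e)

-- Write the order as k = 2 + j, so that "small" means r(A) ≤ j = k − 2.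
-- Every small set A has λ(A) ≤ r(A) + 1 ≤ k − 1, so axiom (T2) applies to it.
--
--  * Any tangle 𝒯 of order 2 + j contains every small set.  By induction on
--    |X|: if X ∉ 𝒯 then E − X ∈ 𝒯 by (T2); for X = ∅ this puts E in 𝒯,
--    which (T3) forbids; otherwise pick e ∈ X, so X − e ∈ 𝒯 by induction,
--    {e} ∈ 𝒯 by (T2) and (T4), and (X − e) ∪ {e} ∪ (E − X) = E violates (T3).
--  * Under vertical k-connectivity every member A of a tangle is small:
--    λ(A) < k, so A or E − A is small; if only E − A were, it would lie in
--    the tangle together with A, and A ∪ (E − A) = E violates (T3).
--  * If r(M) > 3j and r(M) > j + 1, the small sets form a tangle: three small
--    sets span rank at most 3j, and (E − e) ∪ {e} at most j + 1.
--
-- The hypothesis r(M) ≥ max(3k − 5, 2) = max(3j + 1, 2) supplies both rank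
-- bounds, so the small sets form a tangle, and every tangle equals it.
module Submission where

open import Defs
open import Data.Nat using (ℕ; zero; suc; _+_; _*_; _∸_; _≤_; _<_; _⊔_; s≤s; z≤n)
open import Data.Nat.Properties
open import Data.Nat.Induction using (<-wellFounded)
open import Induction.WellFounded using (Acc; acc)
open import Data.Fin using (Fin)
open import Data.Fin.Subset
  using (Subset; ⊥; ⊤; ∁; _∪_; _⊆_; _─_; _-_; ∣_∣; ⁅_⁆; _∈_; inside; outside)
open import Data.Fin.Subset.Properties
open import Data.Vec using (_∷_; []; here; there)
open import Data.Bool.Properties using (∨-identityʳ)
open import Data.Empty using (⊥-elim)
open import Data.Product using (Σ; _×_; _,_)
open import Data.Sum using (_⊎_; inj₁; inj₂)
open import Function.Bundles using (_⇔_; mk⇔)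
open import Relation.Binary.PropositionalEquality
open import Relation.Nullary using (¬_; yes; no)

∁⊥≡⊤ : ∀ {n} → ∁ (⊥ {n}) ≡ ⊤
∁⊥≡⊤ = trans (sym (∪-identityˡ (∁ ⊥))) (p∪∁p≡⊤ ⊥)

⊤─p≡∁p : ∀ {n} (p : Subset n) → ⊤ ─ p ≡ ∁ p
⊤─p≡∁p []            = refl
⊤─p≡∁p (inside  ∷ p) = cong (outside ∷_) (⊤─p≡∁p p)
⊤─p≡∁p (outside ∷ p) = cong (inside ∷_) (⊤─p≡∁p p)

p-x∪⁅x⁆≡p : ∀ {n} (p : Subset n) {x : Fin n} → x ∈ p → (p - x) ∪ ⁅ x ⁆ ≡ p
p-x∪⁅x⁆≡p (.inside ∷ p) here =
  cong (inside ∷_) (trans (cong (_∪ ⊥) (p─⊥≡p p)) (∪-identityʳ p))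
p-x∪⁅x⁆≡p (b ∷ p) (there x∈p) = cong₂ _∷_ (∨-identityʳ b) (p-x∪⁅x⁆≡p p x∈p)

x∈p⇒⁅x⁆⊆p : ∀ {n} {p : Subset n} {x : Fin n} → x ∈ p → ⁅ x ⁆ ⊆ p
x∈p⇒⁅x⁆⊆p {x = x} x∈p y∈⁅x⁆ rewrite x∈⁅y⁆⇒x≡y x y∈⁅x⁆ = x∈p

module RankFacts {n : ℕ} (M : Matroid n) where
  open Matroid M

  r-∪ : ∀ X Y → r (X ∪ Y) ≤ r X + r Y
  r-∪ X Y = ≤-trans (m≤m+n _ _) (r-submod X Y)

  r-⁅⁆ : ∀ e → r ⁅ e ⁆ ≤ 1
  r-⁅⁆ e = ≤-trans (r-bounded _) (≤-reflexive (∣⁅x⁆∣≡1 e))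

  conn≤r+1 : ∀ X → conn M X ≤ r X + 1
  conn≤r+1 X = +-monoˡ-≤ 1 (begin
    (r X + r (∁ X)) ∸ r ⊤ ≤⟨ ∸-monoˡ-≤ (r ⊤) (+-monoʳ-≤ (r X) (r-mono _ _ ⊆⊤)) ⟩
    (r X + r ⊤) ∸ r ⊤     ≡⟨ m+n∸n≡m (r X) (r ⊤) ⟩
    r X                   ∎)
    where open ≤-Reasoning

  small⇒conn≤ : ∀ j X → r X ≤ j → conn M X ≤ suc j
  small⇒conn≤ j X rX≤j =
    ≤-trans (conn≤r+1 X) (≤-trans (+-monoˡ-≤ 1 rX≤j) (≤-reflexive (+-comm j 1)))

  r-cover : ∀ A B C → A ∪ (B ∪ C) ≡ ⊤ → rankM M ≤ r A + (r B + r C)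
  r-cover A B C cover = begin
    r ⊤                 ≡⟨ cong r (sym cover) ⟩
    r (A ∪ (B ∪ C))     ≤⟨ r-∪ A (B ∪ C) ⟩
    r A + r (B ∪ C)     ≤⟨ +-monoʳ-≤ (r A) (r-∪ B C) ⟩
    r A + (r B + r C)   ∎
    where open ≤-Reasoning

module TangleFacts {n : ℕ} (M : Matroid n) (j : ℕ)
                   (𝒯 : Subset n → Set) (t : IsTangle M (2 + j) 𝒯) where
  open Matroid M
  open IsTangle t
  open RankFacts M

  ∁-exclusive : ∀ X → 𝒯 X → ¬ 𝒯 (∁ X)
  ∁-exclusive X X∈𝒯 ∁X∈𝒯 = T3 X (∁ X) (∁ X) X∈𝒯 ∁X∈𝒯 ∁X∈𝒯
    (trans (cong (X ∪_) (∪-idem (∁ X))) (p∪∁p≡⊤ X))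

  small-or-∁ : ∀ X → r X ≤ j → 𝒯 X ⊎ 𝒯 (∁ X)
  small-or-∁ X rX≤j = T2 X (small⇒conn≤ j X rX≤j)

  ⊤∉𝒯 : ¬ 𝒯 ⊤
  ⊤∉𝒯 ⊤∈𝒯 = T3 ⊤ ⊤ ⊤ ⊤∈𝒯 ⊤∈𝒯 ⊤∈𝒯 (∪-zeroˡ (⊤ ∪ ⊤))

  ⁅⁆∈𝒯 : ∀ e → r ⁅ e ⁆ ≤ j → 𝒯 ⁅ e ⁆
  ⁅⁆∈𝒯 e small with small-or-∁ ⁅ e ⁆ small
  ... | inj₁ e∈   = e∈
  ... | inj₂ ∁e∈  = ⊥-elim (T4 e (subst 𝒯 (sym (⊤─p≡∁p ⁅ e ⁆)) ∁e∈))

  small∈𝒯 : ∀ X → r X ≤ j → 𝒯 X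
  small∈𝒯 X small = go X small (<-wellFounded ∣ X ∣)
    where
    go : ∀ X → r X ≤ j → Acc _<_ ∣ X ∣ → 𝒯 X
    go X small (acc smaller) with small-or-∁ X small | nonempty? X
    ... | inj₁ X∈ | _ = X∈
    ... | inj₂ ∁X∈ | no X-empty =
      ⊥-elim (⊤∉𝒯 (subst 𝒯 (trans (cong ∁ (Empty-unique X-empty)) ∁⊥≡⊤) ∁X∈))
    ... | inj₂ ∁X∈ | yes (e , e∈X) =
      ⊥-elim (T3 (X - e) ⁅ e ⁆ (∁ X) X-e∈ ⁅e⁆∈ ∁X∈ cover)
      where
      X-e∈ : 𝒯 (X - e)
      X-e∈ = go (X - e) (≤-trans (r-mono _ _ (p─q⊆p X ⁅ e ⁆)) small)
                (smaller (x∈p⇒∣p-x∣<∣p∣ e∈X))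
      ⁅e⁆∈ : 𝒯 ⁅ e ⁆
      ⁅e⁆∈ = ⁅⁆∈𝒯 e (≤-trans (r-mono _ _ (x∈p⇒⁅x⁆⊆p e∈X)) small)
      cover : (X - e) ∪ (⁅ e ⁆ ∪ ∁ X) ≡ ⊤
      cover = begin
        (X - e) ∪ (⁅ e ⁆ ∪ ∁ X)  ≡⟨ sym (∪-assoc (X - e) ⁅ e ⁆ (∁ X)) ⟩
        ((X - e) ∪ ⁅ e ⁆) ∪ ∁ X  ≡⟨ cong (_∪ ∁ X) (p-x∪⁅x⁆≡p X e∈X) ⟩
        X ∪ ∁ X                  ≡⟨ p∪∁p≡⊤ X ⟩
        ⊤                        ∎
        where open ≡-Reasoning

tangle⇔small : ∀ {n} (M : Matroid n) (j : ℕ) → VerticallyConnected M (2 + j) →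
  ∀ 𝒯 → IsTangle M (2 + j) 𝒯 → ∀ A → 𝒯 A ⇔ Matroid.r M A ≤ j
tangle⇔small M j vc 𝒯 t A = mk⇔ member⇒small (small∈𝒯 A)
  where
  open Matroid M
  open IsTangle t
  open TangleFacts M j 𝒯 t

  -- λ(A) < 2 + j, so A or E − A is small; E − A cannot be in 𝒯 alongside A.
  member⇒small : 𝒯 A → r A ≤ j
  member⇒small A∈𝒯 with vc A (≤-pred (T1 A A∈𝒯))
  ... | inj₁ A-small  = A-small
  ... | inj₂ ∁A-small = ⊥-elim (∁-exclusive A A∈𝒯 (small∈𝒯 (∁ A) ∁A-small))

SmallSets : ∀ {n} → Matroid n → ℕ → Subset n → Set
SmallSets M j A = Matroid.r M A ≤ j

smallSets-tangle : ∀ {n} (M : Matroid n) (j : ℕ) → VerticallyConnected M (2 + j) →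
  3 * j < rankM M → suc j < rankM M → IsTangle M (2 + j) (SmallSets M j)
smallSets-tangle M j vc 3j<rM 1+j<rM = record
  { T1 = λ A A-small → s≤s (small⇒conn≤ j A A-small)
  ; T2 = vc
  ; T3 = λ A B C A-small B-small C-small cover → <⇒≱ 3j<rM (begin
      rankM M           ≤⟨ r-cover A B C cover ⟩
      r A + (r B + r C) ≤⟨ +-mono-≤ A-small (+-mono-≤ B-small C-small) ⟩
      j + (j + j)       ≡⟨ cong (λ x → j + (j + x)) (sym (+-identityʳ j)) ⟩
      3 * j             ∎)
  ; T4 = λ e E-e-small → <⇒≱ 1+j<rM (begin
      rankM M               ≡⟨ cong r (sym (p-x∪⁅x⁆≡p ⊤ ∈⊤)) ⟩
      r ((⊤ - e) ∪ ⁅ e ⁆)   ≤⟨ r-∪ (⊤ - e) ⁅ e ⁆ ⟩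
      r (⊤ - e) + r ⁅ e ⁆   ≤⟨ +-mono-≤ E-e-small (r-⁅⁆ e) ⟩
      j + 1                 ≡⟨ +-comm j 1 ⟩
      suc j                 ∎)
  }
  where
  open Matroid M
  open RankFacts M
  open ≤-Reasoning

3k∸5≡1+3j : ∀ j → 3 * (2 + j) ∸ 5 ≡ suc (3 * j)
3k∸5≡1+3j j = cong (_∸ 5) (*-distribˡ-+ 3 2 j)

rank>3j : ∀ j R → (3 * (2 + j) ∸ 5) ⊔ 2 ≤ R → 3 * j < R
rank>3j j R bound = ≤-trans (≤-reflexive (sym (3k∸5≡1+3j j))) (≤-trans (m≤m⊔n _ 2) bound)

rank>1+j : ∀ j R → (3 * (2 + j) ∸ 5) ⊔ 2 ≤ R → suc j < R
rank>1+j zero    R bound = bound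
rank>1+j (suc i) R bound = ≤-trans 3+i≤1+3[1+i] (≤-trans (m≤m⊔n _ 2) bound)
  where
  3+i≤1+3[1+i] : 3 + i ≤ 3 * (3 + i) ∸ 5
  3+i≤1+3[1+i] = begin
    3 + i               ≤⟨ +-monoʳ-≤ 3 (≤-trans (m≤n*m i 3) (n≤1+n _)) ⟩
    suc (3 + 3 * i)     ≡⟨ cong suc (sym (*-suc 3 i)) ⟩
    suc (3 * suc i)     ≡⟨ sym (3k∸5≡1+3j (suc i)) ⟩
    3 * (3 + i) ∸ 5     ∎
    where open ≤-Reasoning

lemma2p3 : ∀ {n : ℕ} (M : Matroid n) (k : ℕ) → 2 ≤ k →
    VerticallyConnected M k →
    (3 * k ∸ 5) ⊔ 2 ≤ rankM M →
    Σ (Subset n → Set) (λ 𝒯 → IsTangle M k 𝒯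
      × (∀ A → 𝒯 A ⇔ Matroid.r M A ≤ k ∸ 2)
      × (∀ (𝒯′ : Subset n → Set) → IsTangle M k 𝒯′ → ∀ A → 𝒯′ A ⇔ 𝒯 A))
lemma2p3 M (suc (suc j)) (s≤s (s≤s z≤n)) vc bound =
    SmallSets M j
  , smallSets-tangle M j vc (rank>3j j (rankM M) bound) (rank>1+j j (rankM M) bound)
  , (λ A → mk⇔ (λ A-small → A-small) (λ A-small → A-small))
  , tangle⇔small M j vc
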